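{- Let $p$ be an odd prime number and $n > 1$ a natural number. For any prime number $q \neq p$ and any natural number $m$, $Cl_2(\mathbb{Z}_{p^n}) \cong Cl_2(\mathbb{Z}_{q^m})$ if and only if $q = p^n - p^{n-1} + 1$ and $m = 1$ (in particular $p^n - p^{n-1} + 1$ is then a prime number).
   Context: For a ring $R$ with identity, $Id(R)$ denotes the set of idempotents and $U(R)$ the set of units of $R$. The clean graph $Cl(R)$ has vertex set $Id(R) \times U(R)$, and two distinct vertices $(e,u)$ and $(f,v)$ are adjacent if and only if $ef=fe=0$ or $uv=vu=1$. $Cl_2(R)$ is the induced subgraph of $Cl(R)$ on $\{(e,u): e \in Id(R)\setminus\{0\},\ u \in U(R)\}$. $\cong$ denotes graph isomorphism. -}

module Defs where

open import Data.Nat using (ℕ; zero; suc; _*_)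
open import Data.Nat.DivMod using (_mod_)
open import Data.Fin using (Fin; zero; suc; toℕ; _≟_)
open import Data.Fin.Properties using (any?)
open import Data.Bool using (Bool; true; false; T)
open import Data.Product using (Σ; _×_; _,_; proj₁)
open import Data.Sum using (_⊎_)
open import Relation.Nullary using (¬_)
open import Relation.Nullary.Decidable using (⌊_⌋)
open import Relation.Binary.PropositionalEquality using (_≡_)
open import Function.Bundles using (_⇔_)
open import Function.Definitions using (Bijective)

mulZ : ∀ {N} → Fin N → Fin N → Fin N
mulZ {suc k} a b = (toℕ a * toℕ b) mod suc k

zeroZ : ∀ {N} → Fin N → Fin N
zeroZ {suc k} _ = zero

-- the identity of ℤ_N (N ≥ 1); equals zero when N = 1
oneZ : ∀ {N} → Fin N → Fin N
oneZ {suc k} _ = 1 mod suc k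

isIdem : ∀ {N} → Fin N → Bool
isIdem e = ⌊ mulZ e e ≟ e ⌋

isNonzero : ∀ {N} → Fin N → Bool
isNonzero zero    = false
isNonzero (suc _) = true

-- u is a unit: ∃ v, u·v = 1 (ℤ_N is commutative)
isUnit : ∀ {N} → Fin N → Bool
isUnit u = ⌊ any? (λ v → mulZ u v ≟ oneZ u) ⌋

record Graph : Set₁ where
  field
    V   : Set
    Adj : V → V → Set

open Graph public

record _≅_ (G H : Graph) : Set where
  field
    to       : V G → V H
    bijective : Bijective _≡_ _≡_ to
    preserves : ∀ x y → Adj G x y ⇔ Adj H (to x) (to y)

record Cl₂Vertex (N : ℕ) : Set where
  constructor vtx
  field
    e u    : Fin N
    idem   : T (isIdem e)
    nonz   : T (isNonzero e)
    unit   : T (isUnit u)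

open Cl₂Vertex

Cl₂Adj : ∀ {N} → Cl₂Vertex N → Cl₂Vertex N → Set
Cl₂Adj x y =
  ¬ ((e x , u x) ≡ (e y , u y)) ×
  ((mulZ (e x) (e y) ≡ zeroZ (e x) × mulZ (e y) (e x) ≡ zeroZ (e x))
   ⊎ (mulZ (u x) (u y) ≡ oneZ (u x) × mulZ (u y) (u x) ≡ oneZ (u x)))

Cl₂ : ℕ → Graph
Cl₂ N = record { V = Cl₂Vertex N ; Adj = Cl₂Adj }

-- Every nonzero idempotent of ℤ/pⁿ is 1, so a vertex of Cl₂(ℤ/pⁿ) is determined by its unit, and
-- two vertices are adjacent exactly when their units are mutually inverse.  For odd p the only
-- self-inverse units are ±1, so Cl₂(ℤ/pⁿ) is two isolated vertices plus a perfect matching on the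
-- other φ(pⁿ) − 2 vertices, a graph determined by its order φ(pⁿ) = pⁿ⁻¹(p − 1).
-- Counting vertices, an isomorphism Cl₂(ℤ/pⁿ) ≅ Cl₂(ℤ/q^m) forces φ(pⁿ) = φ(q^m): m = 0 is impossible since
-- Cl₂(ℤ/1) is empty, and m ≥ 2 would give both p ∣ q − 1 and q ∣ p − 1.  So m = 1 and q = φ(pⁿ) + 1,
-- which is odd; conversely, for such q both graphs are matchings of the same size.

module Submission where

open import Defs
open import Data.Nat using (ℕ; zero; suc; _^_; _∸_; _+_; _*_; _<_; s≤s; z≤n; NonZero)
open import Data.Nat.Properties hiding (_≟_)
open import Data.Nat.DivMod
open import Data.Nat.Divisibility
open import Data.Nat.Primality using (Prime; prime[2]; euclidsLemma; prime⇒irreducible; prime⇒nonTrivial)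
open import Data.Nat.Base using (nonTrivial⇒n>1)
open import Data.Nat.Coprimality using (Coprime; coprime-divisor; coprime-Bézout) renaming (sym to coprime-sym)
open import Data.Nat.GCD using (module Bézout)
open import Data.Nat.Solver using (module +-*-Solver)
open import Data.Fin as Fin using (Fin; zero; suc; toℕ; _≟_)
open import Data.Fin.Properties
  using (+↔⊎; *↔×; 2↔Bool; cantor-schröder-bernstein; toℕ-injective; toℕ-fromℕ<; toℕ-fromℕ; toℕ<n)
open import Data.Bool using (Bool; true; false; T; if_then_else_)
open import Data.Bool.Properties using (T-irrelevant; T-≡; ⇔→≡)
open import Data.Unit using (tt)
open import Data.Empty using (⊥; ⊥-elim)
open import Data.Product using (Σ; ∃-syntax; _×_; _,_; proj₁; proj₂)
open import Data.Product.Function.NonDependent.Propositional using (_×-↔_)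
open import Data.Sum as Sum using (_⊎_; inj₁; inj₂; [_,_]′)
open import Data.Sum.Function.Propositional using (_⊎-↔_)
open import Relation.Nullary using (¬_; Dec; yes; no; ¬?)
open import Relation.Nullary.Decidable using (⌊_⌋; T?; toWitness; fromWitness)
open import Relation.Binary.Definitions using (tri<; tri≈; tri>)
open import Relation.Binary.PropositionalEquality
open import Function using (_∘_)
open import Function.Bundles
  using (_⇔_; mk⇔; Equivalence; _↔_; mk↔ₛ′; Inverse; Injection; Bijection; mk⤖)
open import Function.Properties.Inverse using (↔-refl; ↔-sym; ↔-trans; ↔⇒↣; ↔⇒⤖)
open import Function.Properties.Bijection using (⤖⇒↔)
open import Function.Properties.Equivalence using () renaming (sym to ⇔-sym; trans to ⇔-trans)

open +-*-Solver using (solve; _:=_; _:+_; _:*_; con)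
open Inverse using (to; from; strictlyInverseˡ; strictlyInverseʳ)

-- Finite types and counting

↔-injective : ∀ {A B : Set} (e : A ↔ B) {x y} → to e x ≡ to e y → x ≡ y
↔-injective e = Injection.injective (↔⇒↣ e)

Fin-↔⇒≡ : ∀ {m n} → Fin m ↔ Fin n → m ≡ n
Fin-↔⇒≡ e = cantor-schröder-bernstein (↔-injective e) (↔-injective (↔-sym e))

count : ∀ {n} → (Fin n → Bool) → ℕ
count {zero}  b = 0
count {suc n} b = (if b zero then 1 else 0) + count (b ∘ suc)

T↔Fin : ∀ c → T c ↔ Fin (if c then 1 else 0)
T↔Fin true  = mk↔ₛ′ (λ _ → zero) (λ _ → tt) (λ { zero → refl }) (λ _ → refl)
T↔Fin false = mk↔ₛ′ (λ ()) (λ ()) (λ ()) (λ ())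

Σ-Fin-suc↔ : ∀ {n} (P : Fin (suc n) → Set) → Σ (Fin (suc n)) P ↔ (P zero ⊎ Σ (Fin n) (P ∘ suc))
Σ-Fin-suc↔ P = mk↔ₛ′
  (λ { (zero , p) → inj₁ p ; (suc i , p) → inj₂ (i , p) })
  (λ { (inj₁ p) → zero , p ; (inj₂ (i , p)) → suc i , p })
  (λ { (inj₁ p) → refl ; (inj₂ (i , p)) → refl })
  (λ { (zero , p) → refl ; (suc i , p) → refl })

Σ-T↔Fin-count : ∀ {n} (b : Fin n → Bool) → Σ (Fin n) (T ∘ b) ↔ Fin (count b)
Σ-T↔Fin-count {zero}  b = mk↔ₛ′ (λ ()) (λ ()) (λ ()) (λ ())
Σ-T↔Fin-count {suc n} b = ↔-trans (Σ-Fin-suc↔ (T ∘ b))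
  (↔-trans (T↔Fin (b zero) ⊎-↔ Σ-T↔Fin-count (b ∘ suc)) (↔-sym +↔⊎))

count-cong : ∀ {n} {b c : Fin n → Bool} → (∀ i → b i ≡ c i) → count b ≡ count c
count-cong {zero}  eq = refl
count-cong {suc n} eq = cong₂ _+_ (cong (λ c → if c then 1 else 0) (eq zero)) (count-cong (eq ∘ suc))

count-true : ∀ n → count {n} (λ _ → true) ≡ n
count-true zero    = refl
count-true (suc n) = cong suc (count-true n)

countBelow : (ℕ → Bool) → ℕ → ℕ
countBelow f n = count {n} (f ∘ toℕ)

countBelow-+ : ∀ f m n → countBelow f (m + n) ≡ countBelow f m + countBelow (f ∘ (m +_)) n
countBelow-+ f zero    n = refl
countBelow-+ f (suc m) n =
  trans (cong (f0 +_) (countBelow-+ (f ∘ suc) m n))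
        (sym (+-assoc f0 (countBelow (f ∘ suc) m) (countBelow (f ∘ (suc m +_)) n)))
  where
  f0 : ℕ
  f0 = if f 0 then 1 else 0

countBelow-periodic : ∀ {f P} → (∀ x → f (P + x) ≡ f x) →
                      ∀ m → countBelow f (m * P) ≡ m * countBelow f P
countBelow-periodic {f} {P} periodic zero    = refl
countBelow-periodic {f} {P} periodic (suc m) = begin
  countBelow f (P + m * P)
    ≡⟨ countBelow-+ f P (m * P) ⟩
  countBelow f P + countBelow (f ∘ (P +_)) (m * P)
    ≡⟨ cong (countBelow f P +_) (count-cong {m * P} (periodic ∘ toℕ)) ⟩
  countBelow f P + countBelow f (m * P)
    ≡⟨ cong (countBelow f P +_) (countBelow-periodic periodic m) ⟩
  countBelow f P + m * countBelow f P
    ∎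
  where open ≡-Reasoning

T⇔⇒≡ : ∀ {x y} → T x ⇔ T y → x ≡ y
T⇔⇒≡ Tx⇔Ty = ⇔→≡ (⇔-trans (⇔-sym T-≡) (⇔-trans Tx⇔Ty T-≡))

-- Graph isomorphisms, involution graphs and matchings

mk≅ : ∀ {G H} (e : V G ↔ V H) → (∀ x y → Adj G x y ⇔ Adj H (to e x) (to e y)) → G ≅ H
mk≅ e adj = record { to = to e ; bijective = Bijection.bijective (↔⇒⤖ e) ; preserves = adj }

≅⇒↔ : ∀ {G H} → G ≅ H → V G ↔ V H
≅⇒↔ i = ⤖⇒↔ (mk⤖ (_≅_.bijective i))

≅-sym : ∀ {G H} → G ≅ H → H ≅ G
≅-sym {G} {H} i = mk≅ (↔-sym e) λ x y → ⇔-sym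
  (subst₂ (λ x′ y′ → Adj G (from e x) (from e y) ⇔ Adj H x′ y′)
          (strictlyInverseˡ e x) (strictlyInverseˡ e y) (_≅_.preserves i (from e x) (from e y)))
  where
  e : V G ↔ V H
  e = ≅⇒↔ i

≅-trans : ∀ {G H K} → G ≅ H → H ≅ K → G ≅ K
≅-trans i j = mk≅ (↔-trans (≅⇒↔ i) (≅⇒↔ j))
  λ x y → ⇔-trans (_≅_.preserves i x y) (_≅_.preserves j _ _)

InvolutionGraph : {A : Set} → (A → A) → Graph
InvolutionGraph {A} σ = record { V = A ; Adj = λ x y → x ≢ y × y ≡ σ x }

InvolutionGraph-conjugate : ∀ {A B : Set} (e : A ↔ B) (σ : A → A) →
  InvolutionGraph σ ≅ InvolutionGraph (to e ∘ σ ∘ from e)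
InvolutionGraph-conjugate e σ = mk≅ e λ x y → mk⇔
  (λ (x≢y , y≡σx) → (λ eq → x≢y (↔-injective e eq))
                   , trans (cong (to e) y≡σx) (cong (to e ∘ σ) (sym (strictlyInverseʳ e x))))
  (λ (x≢y , y≡σx) → (λ eq → x≢y (cong (to e) eq))
                   , ↔-injective e (trans y≡σx (cong (to e ∘ σ) (strictlyInverseʳ e x))))

MatchingAdj : {A B : Set} → A ⊎ (B × Bool) → A ⊎ (B × Bool) → Set
MatchingAdj (inj₂ (x , b)) (inj₂ (y , c)) = x ≡ y × b ≢ c
MatchingAdj _              _              = ⊥

Matching : Set → Set → Graph
Matching A B = record { V = A ⊎ (B × Bool) ; Adj = MatchingAdj }

Matching-cong : ∀ {A A′ B B′ : Set} → A ↔ A′ → B ↔ B′ → Matching A B ≅ Matching A′ B′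
Matching-cong {A} {A′} {B} {B′} eA eB = mk≅ e adj
  where
  e : (A ⊎ (B × Bool)) ↔ (A′ ⊎ (B′ × Bool))
  e = eA ⊎-↔ (eB ×-↔ ↔-refl)
  adj : ∀ x y → MatchingAdj x y ⇔ MatchingAdj (to e x) (to e y)
  adj (inj₁ _)       _              = mk⇔ (λ ()) (λ ())
  adj (inj₂ _)       (inj₁ _)       = mk⇔ (λ ()) (λ ())
  adj (inj₂ (x , b)) (inj₂ (y , c)) = mk⇔
    (λ (x≡y , b≢c) → cong (to eB) x≡y , b≢c)
    (λ (x≡y , b≢c) → ↔-injective eB x≡y , b≢c)

record InvolutionWithTwoFixedPoints (A : Set) : Set where
  field
    σ          : A → A
    involutive : ∀ x → σ (σ x) ≡ x
    a b        : A
    a≢b        : a ≢ b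
    σa≡a       : σ a ≡ a
    σb≡b       : σ b ≡ b
    fixed⇒a⊎b  : ∀ x → σ x ≡ x → x ≡ a ⊎ x ≡ b

conjugate : ∀ {A B : Set} (e : A ↔ B) → InvolutionWithTwoFixedPoints A → InvolutionWithTwoFixedPoints B
conjugate e ι = record
  { σ          = σ′
  ; involutive = λ y → begin
      σ′ (σ′ y)               ≡⟨ σ′-to (σ (from e y)) ⟩
      to e (σ (σ (from e y))) ≡⟨ cong (to e) (involutive (from e y)) ⟩
      to e (from e y)         ≡⟨ strictlyInverseˡ e y ⟩
      y                       ∎
  ; a          = to e a
  ; b          = to e b
  ; a≢b        = λ eq → a≢b (↔-injective e eq)
  ; σa≡a       = trans (σ′-to a) (cong (to e) σa≡a)
  ; σb≡b       = trans (σ′-to b) (cong (to e) σb≡b)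
  ; fixed⇒a⊎b  = λ y σ′y≡y → Sum.map (from≡⇒≡to y) (from≡⇒≡to y)
      (fixed⇒a⊎b (from e y) (↔-injective e (trans σ′y≡y (sym (strictlyInverseˡ e y)))))
  }
  where
  open InvolutionWithTwoFixedPoints ι
  open ≡-Reasoning
  σ′ : _ → _
  σ′ = to e ∘ σ ∘ from e
  σ′-to : ∀ x → σ′ (to e x) ≡ to e (σ x)
  σ′-to x = cong (to e ∘ σ) (strictlyInverseʳ e x)
  from≡⇒≡to : ∀ y {x} → from e y ≡ x → y ≡ to e x
  from≡⇒≡to y eq = trans (sym (strictlyInverseˡ e y)) (cong (to e) eq)

module Decomposition {n : ℕ} (ι : InvolutionWithTwoFixedPoints (Fin n)) where
  open InvolutionWithTwoFixedPoints ι

  isLower : Fin n → Bool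
  isLower i = ⌊ i Fin.<? σ i ⌋

  Lower : Set
  Lower = Σ (Fin n) (T ∘ isLower)

  lower-≡ : {s t : Lower} → proj₁ s ≡ proj₁ t → s ≡ t
  lower-≡ {s , p} {.s , q} refl = cong (s ,_) (T-irrelevant p q)

  σ-injective : ∀ {i j} → σ i ≡ σ j → i ≡ j
  σ-injective {i} {j} eq = trans (sym (involutive i)) (trans (cong σ eq) (involutive j))

  lower⇒< : ∀ {s} → T (isLower s) → s Fin.< σ s
  lower⇒< = toWitness

  lower⇒unfixed : ∀ {s} → T (isLower s) → σ s ≢ s
  lower⇒unfixed l eq = <-irrefl (cong toℕ (sym eq)) (lower⇒< l)

  σ-lower⇒not-lower : ∀ {s} → T (isLower s) → ¬ T (isLower (σ s))
  σ-lower⇒not-lower {s} l l′ = <-asym (lower⇒< l) (subst (σ s Fin.<_) (involutive s) (lower⇒< l′))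

  lower⇒≢fixed : ∀ {s c} → T (isLower s) → σ c ≡ c → s ≢ c
  lower⇒≢fixed l σc≡c refl = lower⇒unfixed l σc≡c

  lower⇒σ≢fixed : ∀ {s c} → T (isLower s) → σ c ≡ c → σ s ≢ c
  lower⇒σ≢fixed {s} l σc≡c σs≡c =
    lower⇒≢fixed l σc≡c (trans (sym (involutive s)) (trans (cong σ σs≡c) σc≡c))

  unfixed-not-lower⇒σ-lower : ∀ {i} → i ≢ a → i ≢ b → ¬ T (isLower i) → T (isLower (σ i))
  unfixed-not-lower⇒σ-lower {i} i≢a i≢b ¬l = fromWitness (subst (σ i Fin.<_) (sym (involutive i)) σi<i)
    where
    σi<i : σ i Fin.< i
    σi<i with <-cmp (toℕ i) (toℕ (σ i))
    ... | tri< i<σi _ _ = ⊥-elim (¬l (fromWitness i<σi))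
    ... | tri≈ _ i≡σi _ = ⊥-elim ([ i≢a , i≢b ]′ (fixed⇒a⊎b i (sym (toℕ-injective i≡σi))))
    ... | tri> _ _ σi<i = σi<i

  -- A vertex other than a and b is coded by the smaller element s of its orbit {s, σ s}
  -- together with a bit saying whether it is s or σ s.
  Parts : Set
  Parts = Fin 2 ⊎ (Lower × Bool)

  assemble : Parts → Fin n
  assemble (inj₁ zero)              = a
  assemble (inj₁ (suc zero))        = b
  assemble (inj₂ ((s , _) , false)) = s
  assemble (inj₂ ((s , _) , true))  = σ s

  classify : ∀ i → Dec (i ≡ a) → Dec (i ≡ b) → Dec (T (isLower i)) → Parts
  classify i (yes _)   _         _        = inj₁ zero
  classify i (no _)    (yes _)   _        = inj₁ (suc zero)
  classify i (no _)    (no _)    (yes l)  = inj₂ ((i , l) , false)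
  classify i (no i≢a)  (no i≢b)  (no ¬l)  = inj₂ ((σ i , unfixed-not-lower⇒σ-lower i≢a i≢b ¬l) , true)

  split : Fin n → Parts
  split i = classify i (i ≟ a) (i ≟ b) (T? (isLower i))

  assemble-classify : ∀ i d₁ d₂ d₃ → assemble (classify i d₁ d₂ d₃) ≡ i
  assemble-classify i (yes i≡a) _         _      = sym i≡a
  assemble-classify i (no _)    (yes i≡b) _      = sym i≡b
  assemble-classify i (no _)    (no _)    (yes _) = refl
  assemble-classify i (no _)    (no _)    (no _)  = involutive i

  classify-a : ∀ d₁ d₂ d₃ → classify a d₁ d₂ d₃ ≡ inj₁ zero
  classify-a (yes _)  _ _ = refl
  classify-a (no a≢a) _ _ = ⊥-elim (a≢a refl)

  classify-b : ∀ d₁ d₂ d₃ → classify b d₁ d₂ d₃ ≡ inj₁ (suc zero)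
  classify-b (yes b≡a) _        _ = ⊥-elim (a≢b (sym b≡a))
  classify-b (no _)    (yes _)  _ = refl
  classify-b (no _)    (no b≢b) _ = ⊥-elim (b≢b refl)

  classify-lower : ∀ {s} (l : T (isLower s)) d₁ d₂ d₃ →
                   classify s d₁ d₂ d₃ ≡ inj₂ ((s , l) , false)
  classify-lower l (yes s≡a) _         _       = ⊥-elim (lower⇒≢fixed l σa≡a s≡a)
  classify-lower l (no _)    (yes s≡b) _       = ⊥-elim (lower⇒≢fixed l σb≡b s≡b)
  classify-lower l (no _)    (no _)    (yes l′) =
    cong (λ l″ → inj₂ ((_ , l″) , false)) (T-irrelevant l′ l)
  classify-lower l (no _)    (no _)    (no ¬l)  = ⊥-elim (¬l l)

  classify-σ-lower : ∀ {s} (l : T (isLower s)) d₁ d₂ d₃ →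
                     classify (σ s) d₁ d₂ d₃ ≡ inj₂ ((s , l) , true)
  classify-σ-lower l (yes σs≡a) _          _       = ⊥-elim (lower⇒σ≢fixed l σa≡a σs≡a)
  classify-σ-lower l (no _)     (yes σs≡b) _       = ⊥-elim (lower⇒σ≢fixed l σb≡b σs≡b)
  classify-σ-lower l (no _)     (no _)     (yes l′) = ⊥-elim (σ-lower⇒not-lower l l′)
  classify-σ-lower l (no _)     (no _)     (no _)   =
    cong (λ s′ → inj₂ (s′ , true)) (lower-≡ (involutive _))

  split-assemble : ∀ p → split (assemble p) ≡ p
  split-assemble (inj₁ zero)              = classify-a _ _ _
  split-assemble (inj₁ (suc zero))        = classify-b _ _ _
  split-assemble (inj₂ ((s , l) , false)) = classify-lower l _ _ _
  split-assemble (inj₂ ((s , l) , true))  = classify-σ-lower l _ _ _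

  Parts↔Fin : Parts ↔ Fin n
  Parts↔Fin = mk↔ₛ′ assemble split assemble-split split-assemble
    where
    assemble-split : ∀ i → assemble (split i) ≡ i
    assemble-split i = assemble-classify i (i ≟ a) (i ≟ b) (T? (isLower i))

  σ-assemble-fixed : ∀ c → σ (assemble (inj₁ c)) ≡ assemble (inj₁ c)
  σ-assemble-fixed zero       = σa≡a
  σ-assemble-fixed (suc zero) = σb≡b

  fixed-has-no-successor : ∀ {c y} → σ c ≡ c → ¬ Adj (InvolutionGraph σ) c y
  fixed-has-no-successor σc≡c (c≢y , y≡σc) = c≢y (sym (trans y≡σc σc≡c))

  fixed-has-no-predecessor : ∀ {x c} → σ c ≡ c → ¬ Adj (InvolutionGraph σ) x c
  fixed-has-no-predecessor {x} σc≡c (x≢c , c≡σx) =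
    x≢c (trans (sym (involutive x)) (trans (cong σ (sym c≡σx)) σc≡c))

  assemble-adjacency : ∀ p q → MatchingAdj p q ⇔ Adj (InvolutionGraph σ) (assemble p) (assemble q)
  assemble-adjacency (inj₁ c) q        =
    mk⇔ (λ ()) (⊥-elim ∘ fixed-has-no-successor (σ-assemble-fixed c))
  assemble-adjacency (inj₂ _) (inj₁ c) =
    mk⇔ (λ ()) (⊥-elim ∘ fixed-has-no-predecessor (σ-assemble-fixed c))
  assemble-adjacency (inj₂ ((s , l) , false)) (inj₂ ((t , l′) , false)) = mk⇔
    (λ { (_ , f≢f) → ⊥-elim (f≢f refl) })
    (λ { (_ , t≡σs) → ⊥-elim (σ-lower⇒not-lower l (subst (T ∘ isLower) t≡σs l′)) })
  assemble-adjacency (inj₂ ((s , l) , false)) (inj₂ ((t , l′) , true)) = mk⇔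
    (λ { (refl , _) → (λ s≡σs → lower⇒unfixed l (sym s≡σs)) , refl })
    (λ { (_ , σt≡σs) → lower-≡ (σ-injective (sym σt≡σs)) , (λ ()) })
  assemble-adjacency (inj₂ ((s , l) , true)) (inj₂ ((t , l′) , false)) = mk⇔
    (λ { (refl , _) → lower⇒unfixed l , sym (involutive s) })
    (λ { (_ , t≡σσs) → lower-≡ (sym (trans t≡σσs (involutive s))) , (λ ()) })
  assemble-adjacency (inj₂ ((s , l) , true)) (inj₂ ((t , l′) , true)) = mk⇔
    (λ { (_ , t≢t) → ⊥-elim (t≢t refl) })
    (λ { (_ , σt≡σσs) →
           ⊥-elim (σ-lower⇒not-lower l (subst (T ∘ isLower) (σ-injective σt≡σσs) l′)) })

  Matching≅InvolutionGraph : Matching (Fin 2) Lower ≅ InvolutionGraph σ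
  Matching≅InvolutionGraph = mk≅ Parts↔Fin assemble-adjacency

Matching-vertices : ∀ j → V (Matching (Fin 2) (Fin j)) ↔ Fin (2 + j * 2)
Matching-vertices j = ↔-sym (↔-trans +↔⊎ (↔-refl ⊎-↔ ↔-trans *↔× (↔-refl ×-↔ 2↔Bool)))

TwoIsolatedPlusMatching : ℕ → Graph → Set
TwoIsolatedPlusMatching m G = ∃[ j ] m ≡ 2 + j * 2 × Matching (Fin 2) (Fin j) ≅ G

TwoIsolatedPlusMatching-unique : ∀ {m G H} →
  TwoIsolatedPlusMatching m G → TwoIsolatedPlusMatching m H → G ≅ H
TwoIsolatedPlusMatching-unique (j , m≡2+2j , iso) (j′ , m≡2+2j′ , iso′)
  with *-cancelʳ-≡ j j′ 2 (+-cancelˡ-≡ 2 _ _ (trans (sym m≡2+2j) m≡2+2j′))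
... | refl = ≅-trans (≅-sym iso) iso′

InvolutionGraph-shape : ∀ {A : Set} {n} (ι : InvolutionWithTwoFixedPoints A) → A ↔ Fin n →
  TwoIsolatedPlusMatching n (InvolutionGraph (InvolutionWithTwoFixedPoints.σ ι))
InvolutionGraph-shape {n = n} ι e = j , size , iso
  where
  open Decomposition (conjugate e ι) using (isLower; Matching≅InvolutionGraph)
  j : ℕ
  j = count isLower
  iso : Matching (Fin 2) (Fin j) ≅ InvolutionGraph (InvolutionWithTwoFixedPoints.σ ι)
  iso = ≅-trans (Matching-cong ↔-refl (↔-sym (Σ-T↔Fin-count isLower)))
                (≅-trans Matching≅InvolutionGraph (≅-sym (InvolutionGraph-conjugate e _)))
  size : n ≡ 2 + j * 2
  size = Fin-↔⇒≡ (↔-trans (↔-sym e) (↔-trans (↔-sym (≅⇒↔ iso)) (Matching-vertices j)))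

-- Elementary number theory

prime>1 : ∀ {P} → Prime P → 1 < P
prime>1 {P} P-prime = nonTrivial⇒n>1 P {{prime⇒nonTrivial P-prime}}

∤⇒coprime-^ : ∀ {P x} → Prime P → P ∤ x → ∀ k → Coprime x (P ^ k)
∤⇒coprime-^ P-prime P∤x zero    (_ , d∣1)         = ∣1⇒≡1 d∣1
∤⇒coprime-^ {P} P-prime P∤x (suc k) {d} (d∣x , d∣P*P^k) =
  ∤⇒coprime-^ P-prime P∤x k (d∣x , coprime-divisor d-coprime-P d∣P*P^k)
  where
  d-coprime-P : Coprime d P
  d-coprime-P (e∣d , e∣P) with prime⇒irreducible P-prime e∣P
  ... | inj₁ e≡1 = e≡1
  ... | inj₂ refl = ⊥-elim (P∤x (∣-trans e∣d d∣x))

coprime-^⇒∤ : ∀ {P x} k → Prime P → Coprime x (P ^ suc k) → P ∤ x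
coprime-^⇒∤ k P-prime coprime P∣x = <-irrefl (sym (coprime (P∣x , m∣m*n _))) (prime>1 P-prime)

prime^∣*⇒∣⊎∣ : ∀ {P x y} k → Prime P → (P ∣ x → P ∤ y) →
               P ^ k ∣ x * y → P ^ k ∣ x ⊎ P ^ k ∣ y
prime^∣*⇒∣⊎∣ {P} {x} {y} k P-prime exclusive P^k∣xy with P ∣? x
... | yes P∣x = inj₁ (coprime-divisor (coprime-sym (∤⇒coprime-^ P-prime (exclusive P∣x) k))
                                      (subst (P ^ k ∣_) (*-comm x y) P^k∣xy))
... | no P∤x  = inj₂ (coprime-divisor (coprime-sym (∤⇒coprime-^ P-prime P∤x k)) P^k∣xy)

∣∧<⇒≡0 : ∀ {m n} → n ∣ m → m < n → m ≡ 0
∣∧<⇒≡0 {zero}  _   _   = refl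
∣∧<⇒≡0 {suc m} n∣m m<n = ⊥-elim (>⇒∤ m<n n∣m)

%-absorbˡ : ∀ m n d .{{_ : NonZero d}} → (m % d) * n % d ≡ m * n % d
%-absorbˡ m n d = begin
  (m % d) * n % d               ≡⟨ %-distribˡ-* (m % d) n d ⟩
  (m % d % d) * (n % d) % d     ≡⟨ cong (λ z → z * (n % d) % d) (m%n%n≡m%n m d) ⟩
  (m % d) * (n % d) % d         ≡⟨ %-distribˡ-* m n d ⟨
  m * n % d                     ∎
  where open ≡-Reasoning

%-absorbʳ : ∀ m n d .{{_ : NonZero d}} → m * (n % d) % d ≡ m * n % d
%-absorbʳ m n d = begin
  m * (n % d) % d  ≡⟨ cong (_% d) (*-comm m (n % d)) ⟩
  (n % d) * m % d  ≡⟨ %-absorbˡ n m d ⟩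
  n * m % d        ≡⟨ cong (_% d) (*-comm n m) ⟩
  m * n % d        ∎
  where open ≡-Reasoning

[m+n]%d≡m⇒d∣n : ∀ {m n d} .{{_ : NonZero d}} → (m + n) % d ≡ m → d ∣ n
[m+n]%d≡m⇒d∣n {m} {n} {d} eq = divides ((m + n) / d) (+-cancelˡ-≡ m n _ (begin
  m + n                         ≡⟨ m≡m%n+[m/n]*n (m + n) d ⟩
  (m + n) % d + (m + n) / d * d ≡⟨ cong (_+ (m + n) / d * d) eq ⟩
  m + (m + n) / d * d           ∎))
  where open ≡-Reasoning

_∤ᵇ_ : ℕ → ℕ → Bool
d ∤ᵇ m = ⌊ ¬? (d ∣? m) ⌋

∤ᵇ-periodic : ∀ P x → P ∤ᵇ (P + x) ≡ P ∤ᵇ x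
∤ᵇ-periodic P x with P ∣? (P + x) | P ∣? x
... | yes _     | yes _   = refl
... | no  _     | no  _   = refl
... | yes P∣P+x | no P∤x  = ⊥-elim (P∤x (∣m+n∣m⇒∣n P∣P+x ∣-refl))
... | no  P∤P+x | yes P∣x = ⊥-elim (P∤P+x (∣m∣n⇒∣m+n ∣-refl P∣x))

countBelow-∤-period : ∀ P → countBelow (suc P ∤ᵇ_) (suc P) ≡ P
countBelow-∤-period P = begin
  countBelow (suc P ∤ᵇ_) (suc P)                   ≡⟨⟩
  countBelow (λ x → suc P ∤ᵇ suc x) P             ≡⟨ count-cong non-multiple ⟩
  count {P} (λ _ → true)                          ≡⟨ count-true P ⟩
  P                                               ∎
  where
  open ≡-Reasoning
  non-multiple : ∀ (i : Fin P) → suc P ∤ᵇ suc (toℕ i) ≡ true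
  non-multiple i with suc P ∣? suc (toℕ i)
  ... | yes P∣1+i = ⊥-elim (>⇒∤ (s≤s (toℕ<n i)) P∣1+i)
  ... | no  _     = refl

countBelow-∤-prime^ : ∀ {P} k → Prime P → countBelow (P ∤ᵇ_) (P ^ suc k) ≡ P ^ k * (P ∸ 1)
countBelow-∤-prime^ {suc P} k _ = begin
  countBelow (suc P ∤ᵇ_) (suc P * suc P ^ k)
    ≡⟨ cong (countBelow (suc P ∤ᵇ_)) (*-comm (suc P) (suc P ^ k)) ⟩
  countBelow (suc P ∤ᵇ_) (suc P ^ k * suc P)
    ≡⟨ countBelow-periodic (∤ᵇ-periodic (suc P)) (suc P ^ k) ⟩
  suc P ^ k * countBelow (suc P ∤ᵇ_) (suc P)
    ≡⟨ cong (suc P ^ k *_) (countBelow-∤-period P) ⟩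
  suc P ^ k * P
    ∎
  where open ≡-Reasoning

T-∤ᵇ : ∀ {d m} → T (d ∤ᵇ m) ⇔ d ∤ m
T-∤ᵇ = mk⇔ toWitness fromWitness

1<prime^ : ∀ {P} k → Prime P → 1 < P ^ suc k
1<prime^ {P} k P-prime = ^-monoʳ-< P (prime>1 P-prime) {0} {suc k} (s≤s z≤n)

prime∤1 : ∀ {P} → Prime P → P ∤ 1
prime∤1 P-prime P∣1 = <-irrefl (sym (∣1⇒≡1 P∣1)) (prime>1 P-prime)

prime∣prime^⇒≡ : ∀ {a b} j → Prime a → Prime b → a ∣ b ^ j → a ≡ b
prime∣prime^⇒≡ zero    a-prime b-prime a∣1 = ⊥-elim (prime∤1 a-prime a∣1)
prime∣prime^⇒≡ {a} {b} (suc j) a-prime b-prime a∣b^[1+j] with euclidsLemma b (b ^ j) a-prime a∣b^[1+j]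
... | inj₂ a∣b^j = prime∣prime^⇒≡ j a-prime b-prime a∣b^j
... | inj₁ a∣b with prime⇒irreducible b-prime a∣b
...   | inj₁ a≡1 = ⊥-elim (<-irrefl (sym a≡1) (prime>1 a-prime))
...   | inj₂ a≡b = a≡b

prime∣prime^*pred⇒< : ∀ {a b} j → Prime a → Prime b → a ≢ b → a ∣ b ^ j * (b ∸ 1) → a < b
prime∣prime^*pred⇒< {a} {b} j a-prime b-prime a≢b a∣ with euclidsLemma (b ^ j) (b ∸ 1) a-prime a∣
... | inj₁ a∣b^j  = ⊥-elim (a≢b (prime∣prime^⇒≡ j a-prime b-prime a∣b^j))
... | inj₂ a∣b∸1 = ∣pred⇒< (prime>1 b-prime) a∣b∸1
  where
  ∣pred⇒< : ∀ {c} → 1 < c → a ∣ c ∸ 1 → a < c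
  ∣pred⇒< {suc zero}    (s≤s ()) _
  ∣pred⇒< {suc (suc _)} _        a∣c∸1 = s≤s (∣⇒≤ a∣c∸1)

p^[1+i]*[p∸1]≡q^j*[q∸1]⇒j≡0 : ∀ {p q} i j → Prime p → Prime q → p ≢ q →
  p ^ suc i * (p ∸ 1) ≡ q ^ j * (q ∸ 1) → j ≡ 0
p^[1+i]*[p∸1]≡q^j*[q∸1]⇒j≡0         i zero    _       _       _   _  = refl
p^[1+i]*[p∸1]≡q^j*[q∸1]⇒j≡0 {p} {q} i (suc j) p-prime q-prime p≢q eq = ⊥-elim (<-asym p<q q<p)
  where
  p<q : p < q
  p<q = prime∣prime^*pred⇒< (suc j) p-prime q-prime p≢q
          (subst (p ∣_) eq (∣m⇒∣m*n (p ∸ 1) (m∣m*n (p ^ i))))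
  q<p : q < p
  q<p = prime∣prime^*pred⇒< (suc i) q-prime p-prime (p≢q ∘ sym)
          (subst (q ∣_) (sym eq) (∣m⇒∣m*n (q ∸ 1) (m∣m*n (q ^ j))))

p^[1+m]∸p^m≡p^m*[p∸1] : ∀ p m → p ^ suc m ∸ p ^ m ≡ p ^ m * (p ∸ 1)
p^[1+m]∸p^m≡p^m*[p∸1] p m = begin
  p * p ^ m ∸ p ^ m     ≡⟨ cong (p * p ^ m ∸_) (*-identityˡ (p ^ m)) ⟨
  p * p ^ m ∸ 1 * p ^ m ≡⟨ *-distribʳ-∸ (p ^ m) p 1 ⟨
  (p ∸ 1) * p ^ m       ≡⟨ *-comm (p ∸ 1) (p ^ m) ⟩
  p ^ m * (p ∸ 1)       ∎
  where open ≡-Reasoning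

2∤⇒2∣∸1 : ∀ {p} → 2 ∤ p → 2 ∣ p ∸ 1
2∤⇒2∣∸1 {zero}              2∤0   = ⊥-elim (2∤0 (2 ∣0))
2∤⇒2∣∸1 {suc zero}          _     = 2 ∣0
2∤⇒2∣∸1 {suc (suc zero)}    2∤2   = ⊥-elim (2∤2 ∣-refl)
2∤⇒2∣∸1 {suc (suc (suc p))} 2∤3+p =
  ∣m∣n⇒∣m+n (∣-refl {2}) (2∤⇒2∣∸1 (λ 2∣1+p → 2∤3+p (∣m∣n⇒∣m+n (∣-refl {2}) 2∣1+p)))

-- The rings ℤ/N

-- The modulus is written 2 + n so that mulZ and oneZ from Defs compute, with oneZ x = 1ᴺ.
module Residues (n : ℕ) where

  N : ℕ
  N = 2 + n

  1ᴺ : Fin N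
  1ᴺ = suc zero

  infixl 7 _·_
  _·_ : Fin N → Fin N → Fin N
  _·_ = mulZ

  toℕ-· : ∀ x y → toℕ (x · y) ≡ toℕ x * toℕ y % N
  toℕ-· x y = toℕ-fromℕ< _

  ·-comm : ∀ x y → x · y ≡ y · x
  ·-comm x y = cong (_mod N) (*-comm (toℕ x) (toℕ y))

  ·-assoc : ∀ x y z → (x · y) · z ≡ x · (y · z)
  ·-assoc x y z = toℕ-injective (begin
    toℕ ((x · y) · z)                ≡⟨ toℕ-· (x · y) z ⟩
    toℕ (x · y) * Z % N              ≡⟨ cong (λ w → w * Z % N) (toℕ-· x y) ⟩
    (X * Y % N) * Z % N              ≡⟨ %-absorbˡ (X * Y) Z N ⟩
    X * Y * Z % N                    ≡⟨ cong (_% N) (*-assoc X Y Z) ⟩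
    X * (Y * Z) % N                  ≡⟨ %-absorbʳ X (Y * Z) N ⟨
    X * (Y * Z % N) % N              ≡⟨ cong (λ w → X * w % N) (toℕ-· y z) ⟨
    X * toℕ (y · z) % N              ≡⟨ toℕ-· x (y · z) ⟨
    toℕ (x · (y · z))                ∎)
    where
    open ≡-Reasoning
    X Y Z : ℕ
    X = toℕ x
    Y = toℕ y
    Z = toℕ z

  ·-identityˡ : ∀ x → 1ᴺ · x ≡ x
  ·-identityˡ x = toℕ-injective (trans (toℕ-· 1ᴺ x)
    (trans (cong (_% N) (*-identityˡ (toℕ x))) (m<n⇒m%n≡m (toℕ<n x))))

  inverse-unique : ∀ u {v w} → u · v ≡ 1ᴺ → u · w ≡ 1ᴺ → v ≡ w
  inverse-unique u {v} {w} uv≡1 uw≡1 = begin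
    v             ≡⟨ ·-identityˡ v ⟨
    1ᴺ · v        ≡⟨ cong (_· v) (trans (sym uw≡1) (·-comm u w)) ⟩
    (w · u) · v   ≡⟨ ·-assoc w u v ⟩
    w · (u · v)   ≡⟨ cong (w ·_) uv≡1 ⟩
    w · 1ᴺ        ≡⟨ ·-comm w 1ᴺ ⟩
    1ᴺ · w        ≡⟨ ·-identityˡ w ⟩
    w             ∎
    where open ≡-Reasoning

  ·≡1⇔ : ∀ x y → x · y ≡ 1ᴺ ⇔ toℕ x * toℕ y % N ≡ 1
  ·≡1⇔ x y = mk⇔ (λ eq → trans (sym (toℕ-· x y)) (cong toℕ eq))
                 (λ eq → toℕ-injective (trans (toℕ-· x y) eq))

  isUnit⇔inverse : ∀ u → T (isUnit u) ⇔ (∃[ v ] u · v ≡ 1ᴺ)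
  isUnit⇔inverse u = mk⇔ toWitness fromWitness

  inverse : ∀ u → T (isUnit u) → Fin N
  inverse u unit-u = proj₁ (Equivalence.to (isUnit⇔inverse u) unit-u)

  ·-inverse : ∀ u unit-u → u · inverse u unit-u ≡ 1ᴺ
  ·-inverse u unit-u = proj₂ (Equivalence.to (isUnit⇔inverse u) unit-u)

  inverse-· : ∀ u unit-u → inverse u unit-u · u ≡ 1ᴺ
  inverse-· u unit-u = trans (·-comm (inverse u unit-u) u) (·-inverse u unit-u)

  inverse-isUnit : ∀ u unit-u → T (isUnit (inverse u unit-u))
  inverse-isUnit u unit-u = Equivalence.from (isUnit⇔inverse (inverse u unit-u)) (u , inverse-· u unit-u)

  self-inverse-vertex : ∀ v → v · v ≡ 1ᴺ → Cl₂Vertex N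
  self-inverse-vertex v v²≡1 = vtx 1ᴺ v tt tt (Equivalence.from (isUnit⇔inverse v) (v , v²≡1))

  idempotent⇒N∣ : ∀ a → suc a · suc a ≡ suc a → N ∣ toℕ a * (1 + toℕ a)
  idempotent⇒N∣ a idem = [m+n]%d≡m⇒d∣n (trans (sym (toℕ-· (suc a) (suc a))) (cong toℕ idem))

  square≡1⇒N∣ : ∀ w → suc w · suc w ≡ 1ᴺ → N ∣ toℕ w * (2 + toℕ w)
  square≡1⇒N∣ w sq≡1 = [m+n]%d≡m⇒d∣n (begin
    (1 + W * (2 + W)) % N  ≡⟨ cong (_% N) (solve 1 (λ W → con 1 :+ W :* (con 2 :+ W)
                                                   := (con 1 :+ W) :* (con 1 :+ W)) refl W) ⟩
    (1 + W) * (1 + W) % N  ≡⟨ Equivalence.to (·≡1⇔ (suc w) (suc w)) sq≡1 ⟩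
    1                      ∎)
    where
    open ≡-Reasoning
    W : ℕ
    W = toℕ w

  -1ᴺ : Fin N
  -1ᴺ = Fin.fromℕ (suc n)

  -1·-1≡1 : -1ᴺ · -1ᴺ ≡ 1ᴺ
  -1·-1≡1 = Equivalence.from (·≡1⇔ -1ᴺ -1ᴺ) (begin
    toℕ -1ᴺ * toℕ -1ᴺ % N  ≡⟨ cong (λ m → m * m % N) (toℕ-fromℕ (suc n)) ⟩
    (1 + n) * (1 + n) % N  ≡⟨ cong (_% N) (solve 1 (λ n → (con 1 :+ n) :* (con 1 :+ n)
                                                   := con 1 :+ n :* (con 2 :+ n)) refl n) ⟩
    (1 + n * N) % N        ≡⟨ [m+kn]%n≡m%n 1 n N ⟩
    1                      ∎)
    where open ≡-Reasoning

  isUnit⇒coprime : ∀ u → T (isUnit u) → Coprime (toℕ u) N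
  isUnit⇒coprime u isUnit-u {d} (d∣u , d∣N) with Equivalence.to (isUnit⇔inverse u) isUnit-u
  ... | v , uv≡1 = ∣1⇒≡1 (subst (d ∣_) (Equivalence.to (·≡1⇔ u v) uv≡1)
                                 (%-presˡ-∣ (∣m⇒∣m*n (toℕ v) d∣u) d∣N))

  ℕ-inverse⇒isUnit : ∀ u w → toℕ u * w % N ≡ 1 → T (isUnit u)
  ℕ-inverse⇒isUnit u w uw≡1 = fromWitness (w mod N , Equivalence.from (·≡1⇔ u (w mod N))
    (trans (cong (λ z → toℕ u * z % N) (toℕ-fromℕ< _)) (trans (%-absorbʳ (toℕ u) w N) uw≡1)))

  coprime⇒isUnit : ∀ u → Coprime (toℕ u) N → T (isUnit u)
  coprime⇒isUnit u coprime with coprime-Bézout coprime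
  ... | Bézout.+- x y 1+yN≡xU = ℕ-inverse⇒isUnit u x (begin
    U * x % N        ≡⟨ cong (_% N) (*-comm U x) ⟩
    x * U % N        ≡⟨ cong (_% N) 1+yN≡xU ⟨
    (1 + y * N) % N  ≡⟨ [m+kn]%n≡m%n 1 y N ⟩
    1                ∎)
    where
    open ≡-Reasoning
    U : ℕ
    U = toℕ u
  -- Here x·u ≡ −1, so (N − 1)·x is an inverse of u.
  ... | Bézout.-+ x y 1+xU≡yN = ℕ-inverse⇒isUnit u ((1 + n) * x) (begin
    U * ((1 + n) * x) % N           ≡⟨ [m+n]%n≡m%n (U * ((1 + n) * x)) N ⟨
    (U * ((1 + n) * x) + N) % N     ≡⟨ cong (_% N) (solve 3 (λ n U x →
                                         U :* ((con 1 :+ n) :* x) :+ (con 2 :+ n)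
                                         := con 1 :+ (con 1 :+ n) :* (con 1 :+ x :* U)) refl n U x) ⟩
    (1 + (1 + n) * (1 + x * U)) % N ≡⟨ cong (λ z → (1 + (1 + n) * z) % N) 1+xU≡yN ⟩
    (1 + (1 + n) * (y * N)) % N     ≡⟨ cong (λ z → (1 + z) % N) (*-assoc (1 + n) y N) ⟨
    (1 + (1 + n) * y * N) % N       ≡⟨ [m+kn]%n≡m%n 1 ((1 + n) * y) N ⟩
    1                               ∎)
    where
    open ≡-Reasoning
    U : ℕ
    U = toℕ u

module PrimePowerResidues {n P : ℕ} (k : ℕ) (P-prime : Prime P) (N≡P^[1+k] : 2 + n ≡ P ^ suc k) where
  open Residues n

  isUnit⇔∤ : ∀ u → T (isUnit u) ⇔ P ∤ toℕ u
  isUnit⇔∤ u = mk⇔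
    (λ isUnit-u → coprime-^⇒∤ k P-prime (subst (Coprime _) N≡P^[1+k] (isUnit⇒coprime u isUnit-u)))
    (λ P∤u → coprime⇒isUnit u (subst (Coprime _) (sym N≡P^[1+k]) (∤⇒coprime-^ P-prime P∤u (suc k))))

  count-isUnit : count (isUnit {N}) ≡ P ^ k * (P ∸ 1)
  count-isUnit = begin
    count (isUnit {N})             ≡⟨ count-cong (λ i → T⇔⇒≡ (⇔-trans (isUnit⇔∤ i) (⇔-sym T-∤ᵇ))) ⟩
    countBelow (P ∤ᵇ_) N          ≡⟨ cong (countBelow (P ∤ᵇ_)) N≡P^[1+k] ⟩
    countBelow (P ∤ᵇ_) (P ^ suc k) ≡⟨ countBelow-∤-prime^ k P-prime ⟩
    P ^ k * (P ∸ 1)               ∎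
    where open ≡-Reasoning

  N∣w*[c+w]⇒N∣w⊎N∣c+w : ∀ {c w} → P ∤ c → N ∣ w * (c + w) → N ∣ w ⊎ N ∣ c + w
  N∣w*[c+w]⇒N∣w⊎N∣c+w {c} {w} P∤c N∣w[c+w] =
    Sum.map (subst (_∣ w) (sym N≡P^[1+k])) (subst (_∣ c + w) (sym N≡P^[1+k]))
      (prime^∣*⇒∣⊎∣ (suc k) P-prime P∣w⇒P∤c+w (subst (_∣ w * (c + w)) N≡P^[1+k] N∣w[c+w]))
    where
    P∣w⇒P∤c+w : P ∣ w → P ∤ c + w
    P∣w⇒P∤c+w P∣w P∣c+w = P∤c (∣m+n∣m⇒∣n (subst (P ∣_) (+-comm c w) P∣c+w) P∣w)

  idempotent≡1 : ∀ e → T (isIdem e) → T (isNonzero e) → e ≡ 1ᴺ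
  idempotent≡1 (suc a) idem _
    with N∣w*[c+w]⇒N∣w⊎N∣c+w (prime∤1 P-prime) (idempotent⇒N∣ a (toWitness idem))
  ... | inj₁ N∣a   = cong suc (toℕ-injective (∣∧<⇒≡0 N∣a (<-trans (n<1+n _) (toℕ<n (suc a)))))
  ... | inj₂ N∣1+a = ⊥-elim (>⇒∤ (toℕ<n (suc a)) N∣1+a)

  module _ (P-odd : 2 ∤ P) where

    P∤2 : P ∤ 2
    P∤2 P∣2 with ≤-antisym (∣⇒≤ P∣2) (prime>1 P-prime)
    ... | refl = P-odd ∣-refl

    1≢-1 : 1ᴺ ≢ -1ᴺ
    1≢-1 1≡-1 = P∤2 (subst (λ m → P ∣ 2 + m) n≡0 P∣N)
      where
      n≡0 : n ≡ 0
      n≡0 = sym (suc-injective (trans (cong toℕ 1≡-1) (toℕ-fromℕ (suc n))))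
      P∣N : P ∣ N
      P∣N = subst (P ∣_) (sym N≡P^[1+k]) (m∣m*n (P ^ k))

    square≡1 : ∀ x → x · x ≡ 1ᴺ → x ≡ 1ᴺ ⊎ x ≡ -1ᴺ
    square≡1 zero    ()
    square≡1 (suc w) sq≡1 with N∣w*[c+w]⇒N∣w⊎N∣c+w P∤2 (square≡1⇒N∣ w sq≡1)
    ... | inj₁ N∣w   =
      inj₁ (cong suc (toℕ-injective (∣∧<⇒≡0 N∣w (<-trans (n<1+n _) (toℕ<n (suc w))))))
    ... | inj₂ N∣2+w = inj₂ (toℕ-injective (trans (cong suc w≡n) (sym (toℕ-fromℕ (suc n)))))
      where
      w≡n : toℕ w ≡ n
      w≡n = suc-injective (suc-injective (≤-antisym (toℕ<n (suc w)) (∣⇒≤ N∣2+w)))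

-- Cl₂ of prime powers

module PrimePowerCl₂ {n P : ℕ} (k : ℕ) (P-prime : Prime P) (N≡P^[1+k] : 2 + n ≡ P ^ suc k) where
  open Residues n
  open PrimePowerResidues k P-prime N≡P^[1+k]
  open Cl₂Vertex

  vertex-≡ : ∀ {x y : Cl₂Vertex N} → e x ≡ e y → u x ≡ u y → x ≡ y
  vertex-≡ {vtx e₀ u₀ idem nonz unit} {vtx .e₀ .u₀ idem′ nonz′ unit′} refl refl
    rewrite T-irrelevant idem idem′ | T-irrelevant nonz nonz′ | T-irrelevant unit unit′ = refl

  e≡1 : ∀ (x : Cl₂Vertex N) → e x ≡ 1ᴺ
  e≡1 x = idempotent≡1 (e x) (idem x) (nonz x)

  vertices↔units : Cl₂Vertex N ↔ Σ (Fin N) (T ∘ isUnit)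
  vertices↔units = mk↔ₛ′ (λ x → u x , unit x) (λ (v , unit-v) → vtx 1ᴺ v tt tt unit-v)
    (λ _ → refl) (λ x → vertex-≡ (sym (e≡1 x)) refl)

  vertices↔Fin : Cl₂Vertex N ↔ Fin (P ^ k * (P ∸ 1))
  vertices↔Fin = ↔-trans vertices↔units
    (subst (λ m → Σ (Fin N) (T ∘ isUnit) ↔ Fin m) count-isUnit (Σ-T↔Fin-count (isUnit {N})))

  u⁻¹ : Cl₂Vertex N → Fin N
  u⁻¹ x = inverse (u x) (unit x)

  invert : Cl₂Vertex N → Cl₂Vertex N
  invert x = vtx (e x) (u⁻¹ x) (idem x) (nonz x) (inverse-isUnit (u x) (unit x))

  invert-involutive : ∀ x → invert (invert x) ≡ x
  invert-involutive x = vertex-≡ refl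
    (inverse-unique (u⁻¹ x) (·-inverse (u⁻¹ x) (inverse-isUnit (u x) (unit x))) (inverse-· (u x) (unit x)))

  Cl₂-adjacency : ∀ x y → Cl₂Adj x y ⇔ Adj (InvolutionGraph invert) x y
  -- Both idempotents are 1 and 1·1 ≢ 0, so only the unit condition can make vertices adjacent.
  Cl₂-adjacency x y = mk⇔
    (λ { (_   , inj₁ (ee≡0 , _)) →
           ⊥-elim (1·1≢0 (subst₂ (λ e₁ e₂ → e₁ · e₂ ≡ zero) (e≡1 x) (e≡1 y) ee≡0))
       ; (x≢y , inj₂ (uv≡1 , _)) → (λ x≡y → x≢y (cong (λ z → e z , u z) x≡y))
                                 , vertex-≡ (trans (e≡1 y) (sym (e≡1 x)))
                                            (inverse-unique (u x) uv≡1 (·-inverse (u x) (unit x))) })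
    (λ { (x≢y , refl) → (λ eq → x≢y (vertex-≡ (cong proj₁ eq) (cong proj₂ eq)))
                      , inj₂ (·-inverse (u x) (unit x) , inverse-· (u x) (unit x)) })
    where
    1·1≢0 : 1ᴺ · 1ᴺ ≢ zero
    1·1≢0 ()

  Cl₂≅InvolutionGraph : Cl₂ N ≅ InvolutionGraph invert
  Cl₂≅InvolutionGraph = mk≅ ↔-refl Cl₂-adjacency

  invert-self-inverse : ∀ x → u x · u x ≡ 1ᴺ → invert x ≡ x
  invert-self-inverse x u²≡1 = vertex-≡ refl (inverse-unique (u x) (·-inverse (u x) (unit x)) u²≡1)

  module _ (P-odd : 2 ∤ P) where

    invert-fixed⇒±1 : ∀ x → invert x ≡ x →
      x ≡ self-inverse-vertex 1ᴺ refl ⊎ x ≡ self-inverse-vertex -1ᴺ -1·-1≡1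
    invert-fixed⇒±1 x invert-x≡x
      with square≡1 P-odd (u x)
             (subst (λ v → u x · v ≡ 1ᴺ) (cong u invert-x≡x) (·-inverse (u x) (unit x)))
    ... | inj₁ u≡1  = inj₁ (vertex-≡ (e≡1 x) u≡1)
    ... | inj₂ u≡-1 = inj₂ (vertex-≡ (e≡1 x) u≡-1)

    inversion : InvolutionWithTwoFixedPoints (Cl₂Vertex N)
    inversion = record
      { σ          = invert
      ; involutive = invert-involutive
      ; a          = self-inverse-vertex 1ᴺ refl
      ; b          = self-inverse-vertex -1ᴺ -1·-1≡1
      ; a≢b        = λ eq → 1≢-1 P-odd (cong u eq)
      ; σa≡a       = invert-self-inverse _ refl
      ; σb≡b       = invert-self-inverse _ -1·-1≡1
      ; fixed⇒a⊎b  = invert-fixed⇒±1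
      }

    Cl₂-shape : TwoIsolatedPlusMatching (P ^ k * (P ∸ 1)) (Cl₂ N)
    Cl₂-shape =
      let j , size , iso = InvolutionGraph-shape inversion vertices↔Fin
      in  j , size , ≅-trans iso (≅-sym Cl₂≅InvolutionGraph)

Cl₂Vertex-inhabited : ∀ {N} → 1 < N → Cl₂Vertex N
Cl₂Vertex-inhabited {suc zero}    (s≤s ())
Cl₂Vertex-inhabited {suc (suc n)} _ = Residues.self-inverse-vertex n (suc zero) refl

Cl₂Vertex-1-empty : ¬ Cl₂Vertex 1
Cl₂Vertex-1-empty (vtx zero _ _ () _)

primePower≡2+ : ∀ {P} k → Prime P → ∃[ n ] 2 + n ≡ P ^ suc k
primePower≡2+ k P-prime = m≤n⇒∃[o]m+o≡n (1<prime^ k P-prime)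

Cl₂-primePower-vertices : ∀ {P} k → Prime P → V (Cl₂ (P ^ suc k)) ↔ Fin (P ^ k * (P ∸ 1))
Cl₂-primePower-vertices {P} k P-prime with primePower≡2+ k P-prime
... | n , N≡P^[1+k] = subst (λ N → Cl₂Vertex N ↔ Fin (P ^ k * (P ∸ 1))) N≡P^[1+k]
                            (PrimePowerCl₂.vertices↔Fin k P-prime N≡P^[1+k])

Cl₂-primePower-shape : ∀ {P} k → Prime P → 2 ∤ P →
  TwoIsolatedPlusMatching (P ^ k * (P ∸ 1)) (Cl₂ (P ^ suc k))
Cl₂-primePower-shape {P} k P-prime P-odd with primePower≡2+ k P-prime
... | n , N≡P^[1+k] = subst (λ N → TwoIsolatedPlusMatching (P ^ k * (P ∸ 1)) (Cl₂ N)) N≡P^[1+k]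
                            (PrimePowerCl₂.Cl₂-shape k P-prime N≡P^[1+k] P-odd)

Cl₂≅⇒q≡φ+1∧m≡1 : ∀ {p q} i m → Prime p → Prime q → q ≢ p →
  Cl₂ (p ^ suc (suc i)) ≅ Cl₂ (q ^ m) → q ≡ p ^ suc i * (p ∸ 1) + 1 × m ≡ 1
Cl₂≅⇒q≡φ+1∧m≡1 i zero p-prime _ _ iso =
  ⊥-elim (Cl₂Vertex-1-empty (_≅_.to iso (Cl₂Vertex-inhabited (1<prime^ (suc i) p-prime))))
Cl₂≅⇒q≡φ+1∧m≡1 {p} {q} i (suc j) p-prime q-prime q≢p iso = q≡φ+1 , cong suc j≡0
  where
  φ-equal : p ^ suc i * (p ∸ 1) ≡ q ^ j * (q ∸ 1)
  φ-equal = Fin-↔⇒≡ (↔-trans (↔-sym (Cl₂-primePower-vertices (suc i) p-prime))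
                    (↔-trans (≅⇒↔ iso) (Cl₂-primePower-vertices j q-prime)))
  j≡0 : j ≡ 0
  j≡0 = p^[1+i]*[p∸1]≡q^j*[q∸1]⇒j≡0 i j p-prime q-prime (q≢p ∘ sym) φ-equal
  q≡φ+1 : q ≡ p ^ suc i * (p ∸ 1) + 1
  q≡φ+1 = begin
    q                       ≡⟨ m∸n+n≡m (<⇒≤ (prime>1 q-prime)) ⟨
    q ∸ 1 + 1               ≡⟨ cong (_+ 1) (*-identityˡ (q ∸ 1)) ⟨
    q ^ 0 * (q ∸ 1) + 1     ≡⟨ cong (λ j → q ^ j * (q ∸ 1) + 1) j≡0 ⟨
    q ^ j * (q ∸ 1) + 1     ≡⟨ cong (_+ 1) φ-equal ⟨
    p ^ suc i * (p ∸ 1) + 1 ∎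
    where open ≡-Reasoning

q≡φ+1⇒Cl₂≅ : ∀ {p q} i → Prime p → 2 ∤ p → Prime q → q ≡ p ^ suc i * (p ∸ 1) + 1 →
  Cl₂ (p ^ suc (suc i)) ≅ Cl₂ (q ^ 1)
q≡φ+1⇒Cl₂≅ {p} {q} i p-prime p-odd q-prime q≡φ+1 =
  TwoIsolatedPlusMatching-unique (Cl₂-primePower-shape (suc i) p-prime p-odd)
    (subst (λ m → TwoIsolatedPlusMatching m (Cl₂ (q ^ 1))) q∸1≡φ (Cl₂-primePower-shape 0 q-prime q-odd))
  where
  q∸1≡φ : q ^ 0 * (q ∸ 1) ≡ p ^ suc i * (p ∸ 1)
  q∸1≡φ = trans (*-identityˡ (q ∸ 1)) (trans (cong (_∸ 1) q≡φ+1) (m+n∸n≡m _ 1))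
  q-odd : 2 ∤ q
  q-odd 2∣q = prime∤1 prime[2]
    (∣m+n∣m⇒∣n (subst (2 ∣_) q≡φ+1 2∣q) (∣n⇒∣m*n (p ^ suc i) (2∤⇒2∣∸1 p-odd)))

mainTheorem6 : (p n : ℕ) → Prime p → ¬ (2 ∣ p) → 1 < n →
    (q m : ℕ) → Prime q → ¬ (q ≡ p) →
    (Cl₂ (p ^ n) ≅ Cl₂ (q ^ m)) ⇔ ((q ≡ (p ^ n ∸ p ^ (n ∸ 1)) + 1) × (m ≡ 1))
mainTheorem6 p zero          _       _     ()        _ _ _       _
mainTheorem6 p (suc zero)    _       _     (s≤s ()) _ _ _       _
mainTheorem6 p (suc (suc i)) p-prime p-odd _        q m q-prime q≢p =
  subst (λ φ → (Cl₂ (p ^ suc (suc i)) ≅ Cl₂ (q ^ m)) ⇔ ((q ≡ φ + 1) × (m ≡ 1)))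
        (sym (p^[1+m]∸p^m≡p^m*[p∸1] p (suc i)))
        (mk⇔ (Cl₂≅⇒q≡φ+1∧m≡1 i m p-prime q-prime q≢p)
             (λ { (q≡φ+1 , refl) → q≡φ+1⇒Cl₂≅ i p-prime p-odd q-prime q≡φ+1 }))
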